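{- Let $\Gamma$ be a finite bipartite graph with vertex bipartition $V(\Gamma) = X \cup Y$, $X=\{x_1,\dots,x_{|X|}\}$, where $d(x_i)=s_i$ for $1\le i\le |X|$ and $d(y)=k$ for all $y \in Y$. Suppose that every pair of distinct vertices $y_1,y_2\in Y$ at distance $2$ in $\Gamma$ has exactly $\mu$ common neighbours. Then $(|Y|-1)\mu \ge k\left(\frac{|Y|\cdot k}{|X|}-1\right)$, with equality if and only if $s_1=s_2=\cdots=s_{|X|}$ and every pair of distinct vertices of $Y$ is at distance $2$.
   Context: $d(z)$ denotes the valency (degree) of a vertex $z$; distances are measured in $\Gamma$. -}

module Defs where

open import Data.Nat using (ℕ; zero; suc; _+_)
open import Data.Fin using (Fin; zero; suc)
open import Data.Bool using (Bool; true; false; _∧_; if_then_else_)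
open import Data.Product using (_×_; ∃)
open import Relation.Binary.PropositionalEquality using (_≡_; _≢_)

-- A finite bipartite graph Γ with parts X = Fin m and Y = Fin n is given by
-- its bipartite adjacency relation  A x y = true  iff  x ~ y.
-- (There are no edges inside X or inside Y.)
BipGraph : ℕ → ℕ → Set
BipGraph m n = Fin m → Fin n → Bool

sumFin : (n : ℕ) → (Fin n → ℕ) → ℕ
sumFin zero    f = 0
sumFin (suc n) f = f zero + sumFin n (λ i → f (suc i))

indic : Bool → ℕ
indic b = if b then 1 else 0

degX : ∀ {m n} → BipGraph m n → Fin m → ℕ
degX {m} {n} A x = sumFin n (λ y → indic (A x y))

degY : ∀ {m n} → BipGraph m n → Fin n → ℕ
degY {m} {n} A y = sumFin m (λ x → indic (A x y))

commonNbrs : ∀ {m n} → BipGraph m n → Fin n → Fin n → ℕ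
commonNbrs {m} {n} A y₁ y₂ = sumFin m (λ x → indic (A x y₁ ∧ A x y₂))

-- y₁, y₂ ∈ Y are at distance 2 in Γ: they are distinct, not adjacent
-- (automatic, as Y is independent), and have a common neighbour.
Dist2 : ∀ {m n} → BipGraph m n → Fin n → Fin n → Set
Dist2 A y₁ y₂ = y₁ ≢ y₂ × ∃ λ x → (A x y₁ ≡ true) × (A x y₂ ≡ true)

-- Counting edges gives Σ sᵢ = |Y| k, and counting pairs of edges x y₁, x y₂ with a common end x ∈ X gives
-- Σ sᵢ² = Σ_{y₁,y₂} |Γ(y₁) ∩ Γ(y₂)|. A diagonal term equals k, and an off-diagonal term is μ or 0 according as
-- y₁, y₂ are at distance 2 or not, so Σ sᵢ² ≤ |Y| (k + (|Y| - 1) μ), with equality iff all pairs are at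
-- distance 2. Cauchy–Schwarz, (Σ sᵢ)² ≤ |X| Σ sᵢ² with equality iff the sᵢ are all equal, then gives
-- |Y| k² ≤ |X| (k + (|Y| - 1) μ), which is the claim multiplied by |X|.

module Submission where

open import Defs
open import Data.Bool using (true; false; _∧_)
open import Data.Bool.Properties using (∧-idem; ∧-conicalˡ; ∧-conicalʳ; ¬-not)
import Data.Bool as Bool
open import Data.Fin using (Fin; zero; suc; punchIn; punchOut)
open import Data.Fin.Properties using (any?; punchInᵢ≢i; punchIn-punchOut)
open import Data.Integer as ℤ using (ℤ; +_; -[1+_]; +≤+; 0ℤ)
import Data.Integer.Properties as ℤ
import Data.Integer.Tactic.RingSolver as ℤ-Solver
open import Data.List using (_∷_; [])
open import Data.Nat using (ℕ; zero; suc; _+_; _*_; _≤_; z≤n; ∣_-_∣; NonZero; _≟_)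
open import Data.Nat.Properties
open import Data.Nat.Tactic.RingSolver using (solve-∀; solve)
open import Data.Product using (_×_; _,_; ∃)
open import Data.Product.Function.NonDependent.Propositional using (_×-⇔_)
open import Data.Rational using (ℚ; _/_; 1ℚ; _-_; toℚᵘ) renaming (_*_ to _*ℚ_)
import Data.Rational as ℚ
open import Data.Rational.Properties
  using (toℚᵘ-homo-*; toℚᵘ-homo-+; toℚᵘ-fromℚᵘ; toℚᵘ-cancel-≤; toℚᵘ-injective; toℚᵘ-cong)
open import Data.Rational.Unnormalised as ℚᵘ using (ℚᵘ; mkℚᵘ; ↥_; ↧_; *≤*; *≡*; _≃_)
import Data.Rational.Unnormalised.Properties as ℚᵘ
open import Data.Sum using ([_,_]′)
open import Function using (_∘_; id)
open import Function.Bundles using (_⇔_; mk⇔; Equivalence)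
open import Function.Construct.Composition using (_⇔-∘_)
open import Relation.Binary.PropositionalEquality
open import Relation.Nullary using (yes; no; contradiction)
open import Algebra.Properties.Semiring.Sum +-*-semiring
  using (sum; sum-syntax; ∑-distrib-+; ∑-comm; *-distribˡ-sum; *-distribʳ-sum; sum-cong-≗; sum-replicate-zero; sum-remove)

sumFin≡sum : ∀ n (f : Fin n → ℕ) → sumFin n f ≡ sum f
sumFin≡sum zero    f = refl
sumFin≡sum (suc n) f = cong (_+_ (f zero)) (sumFin≡sum n (f ∘ suc))

sum-const : ∀ n c → ∑[ i < n ] c ≡ n * c
sum-const zero    c = refl
sum-const (suc n) c = cong (_+_ c) (sum-const n c)

sum-mono-≤ : ∀ {n} {f g : Fin n → ℕ} → (∀ i → f i ≤ g i) → sum f ≤ sum g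
sum-mono-≤ {zero}  f≤g = z≤n
sum-mono-≤ {suc n} f≤g = +-mono-≤ (f≤g zero) (sum-mono-≤ (f≤g ∘ suc))

sum-mono-≤-≡⇒≗ : ∀ {n} {f g : Fin n → ℕ} → (∀ i → f i ≤ g i) → sum f ≡ sum g → ∀ i → f i ≡ g i
sum-mono-≤-≡⇒≗ {suc n} {f} {g} f≤g Σf≡Σg = go
  where
  head≡ : f zero ≡ g zero
  head≡ = ≤-antisym (f≤g zero) (+-cancelʳ-≤ _ _ _ (begin
    g zero + sum (f ∘ suc) ≤⟨ +-monoʳ-≤ (g zero) (sum-mono-≤ (f≤g ∘ suc)) ⟩
    g zero + sum (g ∘ suc) ≡⟨ Σf≡Σg ⟨
    f zero + sum (f ∘ suc) ∎))
    where open ≤-Reasoning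
  tail≡ : sum (f ∘ suc) ≡ sum (g ∘ suc)
  tail≡ = +-cancelˡ-≡ (f zero) _ _ (trans Σf≡Σg (cong (_+ sum (g ∘ suc)) (sym head≡)))
  go : ∀ i → f i ≡ g i
  go zero    = head≡
  go (suc i) = sum-mono-≤-≡⇒≗ (f≤g ∘ suc) tail≡ i

sum-*-sum : ∀ {m n} (f : Fin m → ℕ) (g : Fin n → ℕ) → sum f * sum g ≡ ∑[ i < m ] ∑[ j < n ] (f i * g j)
sum-*-sum f g = trans (*-distribʳ-sum (sum g) f) (sum-cong-≗ (λ i → *-distribˡ-sum (f i) g))

sum≡0⇒≗0 : ∀ {n} {f : Fin n → ℕ} → sum f ≡ 0 → ∀ i → f i ≡ 0
sum≡0⇒≗0 {n} Σf≡0 i = sym (sum-mono-≤-≡⇒≗ (λ _ → z≤n) (trans (sum-replicate-zero n) (sym Σf≡0)) i)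

a²+b²≡2ab+∣a-b∣² : ∀ a b → a * a + b * b ≡ 2 * (a * b) + ∣ a - b ∣ * ∣ a - b ∣
a²+b²≡2ab+∣a-b∣² zero    b       = refl
a²+b²≡2ab+∣a-b∣² (suc a) zero    =
  trans (+-comm (suc a * suc a) 0) (cong (λ x → 2 * x + suc a * suc a) (sym (*-zeroʳ (suc a))))
a²+b²≡2ab+∣a-b∣² (suc a) (suc b) = begin
  suc a * suc a + suc b * suc b                     ≡⟨ solve (a ∷ b ∷ []) ⟩
  (a * a + b * b) + 2 * (a + b + 1)                 ≡⟨ cong (_+ 2 * (a + b + 1)) (a²+b²≡2ab+∣a-b∣² a b) ⟩
  2 * (a * b) + d * d + 2 * (a + b + 1)             ≡⟨ rearrange a b d ⟩
  2 * (suc a * suc b) + d * d                       ∎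
  where
  open ≡-Reasoning
  d = ∣ a - b ∣
  rearrange : ∀ a b d → 2 * (a * b) + d * d + 2 * (a + b + 1) ≡ 2 * (suc a * suc b) + d * d
  rearrange = solve-∀

module _ {m : ℕ} (s : Fin m → ℕ) where

  private
    δ² : Fin m → Fin m → ℕ
    δ² i j = ∣ s i - s j ∣ * ∣ s i - s j ∣

  spread : ℕ
  spread = ∑[ i < m ] ∑[ j < m ] δ² i j

  lagrange-identity : 2 * (m * ∑[ i < m ] (s i * s i)) ≡ 2 * (sum s * sum s) + spread
  lagrange-identity = begin
    2 * (m * T)
      ≡⟨ cong (_+_ (m * T)) (+-identityʳ (m * T)) ⟩
    m * T + m * T
      ≡⟨ cong₂ _+_ row-sum (sym (sum-const m T)) ⟩
    ∑[ i < m ] ∑[ j < m ] (s i * s i) + ∑[ i < m ] T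
      ≡⟨ ∑-distrib-+ (λ i → ∑[ j < m ] (s i * s i)) (λ _ → T) ⟨
    ∑[ i < m ] (∑[ j < m ] (s i * s i) + T)
      ≡⟨ sum-cong-≗ (λ i → ∑-distrib-+ (λ _ → s i * s i) (λ j → s j * s j)) ⟨
    ∑[ i < m ] ∑[ j < m ] (s i * s i + s j * s j)
      ≡⟨ sum-cong-≗ (λ i → sum-cong-≗ (λ j → a²+b²≡2ab+∣a-b∣² (s i) (s j))) ⟩
    ∑[ i < m ] ∑[ j < m ] (2 * (s i * s j) + δ² i j)
      ≡⟨ sum-cong-≗ (λ i → ∑-distrib-+ (λ j → 2 * (s i * s j)) (δ² i)) ⟩
    ∑[ i < m ] (∑[ j < m ] (2 * (s i * s j)) + ∑[ j < m ] δ² i j)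
      ≡⟨ ∑-distrib-+ (λ i → ∑[ j < m ] (2 * (s i * s j))) (λ i → ∑[ j < m ] δ² i j) ⟩
    ∑[ i < m ] ∑[ j < m ] (2 * (s i * s j)) + spread
      ≡⟨ cong (_+ spread) cross-terms ⟩
    2 * (sum s * sum s) + spread
      ∎
    where
    open ≡-Reasoning
    T = ∑[ i < m ] (s i * s i)
    row-sum : m * T ≡ ∑[ i < m ] ∑[ j < m ] (s i * s i)
    row-sum = trans (*-distribˡ-sum m (λ i → s i * s i)) (sum-cong-≗ (λ i → sym (sum-const m (s i * s i))))
    cross-terms : ∑[ i < m ] ∑[ j < m ] (2 * (s i * s j)) ≡ 2 * (sum s * sum s)
    cross-terms = begin
      ∑[ i < m ] ∑[ j < m ] (2 * (s i * s j)) ≡⟨ sum-cong-≗ (λ i → *-distribˡ-sum 2 (λ j → s i * s j)) ⟨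
      ∑[ i < m ] (2 * ∑[ j < m ] (s i * s j)) ≡⟨ *-distribˡ-sum 2 (λ i → ∑[ j < m ] (s i * s j)) ⟨
      2 * ∑[ i < m ] ∑[ j < m ] (s i * s j)   ≡⟨ cong (2 *_) (sum-*-sum s s) ⟨
      2 * (sum s * sum s)                     ∎

  spread≡0⇔const : spread ≡ 0 ⇔ (∀ i j → s i ≡ s j)
  spread≡0⇔const = mk⇔ to from
    where
    x²≡0⇒x≡0 : ∀ x → x * x ≡ 0 → x ≡ 0
    x²≡0⇒x≡0 x x²≡0 = [ id , id ]′ (m*n≡0⇒m≡0∨n≡0 x x²≡0)
    to : spread ≡ 0 → ∀ i j → s i ≡ s j
    to spread≡0 i j = ∣m-n∣≡0⇒m≡n (x²≡0⇒x≡0 ∣ s i - s j ∣ (sum≡0⇒≗0 (sum≡0⇒≗0 spread≡0 i) j))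
    from : (∀ i j → s i ≡ s j) → spread ≡ 0
    from const = trans (sum-cong-≗ row≡0) (sum-replicate-zero m)
      where
      row≡0 : ∀ i → ∑[ j < m ] δ² i j ≡ 0
      row≡0 i = trans (sum-cong-≗ (λ j → cong (λ d → d * d) (m≡n⇒∣m-n∣≡0 (const i j)))) (sum-replicate-zero m)

  cauchy-schwarz : sum s * sum s ≤ m * ∑[ i < m ] (s i * s i)
  cauchy-schwarz = *-cancelˡ-≤ 2 (begin
    2 * (sum s * sum s)              ≤⟨ m≤m+n _ spread ⟩
    2 * (sum s * sum s) + spread     ≡⟨ lagrange-identity ⟨
    2 * (m * ∑[ i < m ] (s i * s i)) ∎)
    where open ≤-Reasoning

  cauchy-schwarz-≡⇔const : sum s * sum s ≡ m * ∑[ i < m ] (s i * s i) ⇔ (∀ i j → s i ≡ s j)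
  cauchy-schwarz-≡⇔const = spread≡0⇔const ⇔-∘ mk⇔ spread≡0 S²≡mT
    where
    S² = sum s * sum s
    mT = m * ∑[ i < m ] (s i * s i)
    spread≡0 : S² ≡ mT → spread ≡ 0
    spread≡0 S²≡mT = +-cancelˡ-≡ (2 * S²) spread 0
      (trans (sym lagrange-identity) (trans (cong (2 *_) (sym S²≡mT)) (sym (+-identityʳ (2 * S²)))))
    S²≡mT : spread ≡ 0 → S² ≡ mT
    S²≡mT spread≡0 = *-cancelˡ-≡ S² mT 2
      (sym (trans lagrange-identity (trans (cong (_+_ (2 * S²)) spread≡0) (+-identityʳ (2 * S²)))))

module BoundChain {m n k S T C : ℕ} .{{_ : NonZero m}} .{{_ : NonZero n}}
         (S≡nk : S ≡ n * k) (S²≤mT : S * S ≤ m * T) (T≤nC : T ≤ n * C) where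

  private
    S²≡n[nkk] : S * S ≡ n * (n * k * k)
    S²≡n[nkk] = trans (cong (λ x → x * x) S≡nk) (solve (n ∷ k ∷ []))

    m[nC]≡n[mC] : m * (n * C) ≡ n * (m * C)
    m[nC]≡n[mC] = solve (m ∷ n ∷ C ∷ [])

    mT≤m[nC] : m * T ≤ m * (n * C)
    mT≤m[nC] = *-monoʳ-≤ m T≤nC

  nk²≤mC : n * k * k ≤ m * C
  nk²≤mC = *-cancelˡ-≤ n (begin
    n * (n * k * k) ≡⟨ S²≡n[nkk] ⟨
    S * S           ≤⟨ S²≤mT ⟩
    m * T           ≤⟨ mT≤m[nC] ⟩
    m * (n * C)     ≡⟨ m[nC]≡n[mC] ⟩
    n * (m * C)     ∎)
    where open ≤-Reasoning

  nk²≡mC⇔ : n * k * k ≡ m * C ⇔ (S * S ≡ m * T × T ≡ n * C)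
  nk²≡mC⇔ = mk⇔ to from
    where
    to : n * k * k ≡ m * C → S * S ≡ m * T × T ≡ n * C
    to nk²≡mC = ≤-antisym S²≤mT (subst (m * T ≤_) (sym S²≡m[nC]) mT≤m[nC])
              , *-cancelˡ-≡ T (n * C) m (≤-antisym mT≤m[nC] (subst (_≤ m * T) S²≡m[nC] S²≤mT))
      where
      S²≡m[nC] : S * S ≡ m * (n * C)
      S²≡m[nC] = trans S²≡n[nkk] (trans (cong (n *_) nk²≡mC) (sym m[nC]≡n[mC]))
    from : S * S ≡ m * T × T ≡ n * C → n * k * k ≡ m * C
    from (S²≡mT , T≡nC) = *-cancelˡ-≡ (n * k * k) (m * C) n (begin
      n * (n * k * k) ≡⟨ S²≡n[nkk] ⟨
      S * S           ≡⟨ S²≡mT ⟩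
      m * T           ≡⟨ cong (m *_) T≡nC ⟩
      m * (n * C)     ≡⟨ m[nC]≡n[mC] ⟩
      n * (m * C)     ∎)
      where open ≡-Reasoning

indic-∧ : ∀ a b → indic (a ∧ b) ≡ indic a * indic b
indic-∧ true  b = sym (+-identityʳ (indic b))
indic-∧ false b = refl

module _ {m n : ℕ} (A : BipGraph m n) where

  sum-degX≡sum-degY : sum (degX A) ≡ sum (degY A)
  sum-degX≡sum-degY = begin
    sum (degX A)                        ≡⟨ sum-cong-≗ (λ x → sumFin≡sum n (λ y → indic (A x y))) ⟩
    ∑[ x < m ] ∑[ y < n ] indic (A x y) ≡⟨ ∑-comm (λ x y → indic (A x y)) ⟩
    ∑[ y < n ] ∑[ x < m ] indic (A x y) ≡⟨ sum-cong-≗ (λ y → sumFin≡sum m (λ x → indic (A x y))) ⟨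
    sum (degY A)                        ∎
    where open ≡-Reasoning

  sum-degX²≡sum-commonNbrs : ∑[ x < m ] (degX A x * degX A x) ≡ ∑[ y₁ < n ] ∑[ y₂ < n ] commonNbrs A y₁ y₂
  sum-degX²≡sum-commonNbrs = begin
    ∑[ x < m ] (degX A x * degX A x)
      ≡⟨ sum-cong-≗ (λ x → cong (λ d → d * d) (sumFin≡sum n (λ y → indic (A x y)))) ⟩
    ∑[ x < m ] (∑[ y < n ] indic (A x y) * ∑[ y < n ] indic (A x y))
      ≡⟨ sum-cong-≗ (λ x → sum-*-sum (λ y → indic (A x y)) (λ y → indic (A x y))) ⟩
    ∑[ x < m ] ∑[ y₁ < n ] ∑[ y₂ < n ] (indic (A x y₁) * indic (A x y₂))
      ≡⟨ sum-cong-≗ (λ x → sum-cong-≗ (λ y₁ → sum-cong-≗ (λ y₂ → indic-∧ (A x y₁) (A x y₂)))) ⟨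
    ∑[ x < m ] ∑[ y₁ < n ] ∑[ y₂ < n ] indic (A x y₁ ∧ A x y₂)
      ≡⟨ ∑-comm (λ x y₁ → ∑[ y₂ < n ] indic (A x y₁ ∧ A x y₂)) ⟩
    ∑[ y₁ < n ] ∑[ x < m ] ∑[ y₂ < n ] indic (A x y₁ ∧ A x y₂)
      ≡⟨ sum-cong-≗ (λ y₁ → ∑-comm (λ x y₂ → indic (A x y₁ ∧ A x y₂))) ⟩
    ∑[ y₁ < n ] ∑[ y₂ < n ] ∑[ x < m ] indic (A x y₁ ∧ A x y₂)
      ≡⟨ sum-cong-≗ (λ y₁ → sum-cong-≗ (λ y₂ → sumFin≡sum m (λ x → indic (A x y₁ ∧ A x y₂)))) ⟨
    ∑[ y₁ < n ] ∑[ y₂ < n ] commonNbrs A y₁ y₂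
      ∎
    where open ≡-Reasoning

  commonNbrs-diagonal : ∀ y → commonNbrs A y y ≡ degY A y
  commonNbrs-diagonal y = begin
    commonNbrs A y y                 ≡⟨ sumFin≡sum m (λ x → indic (A x y ∧ A x y)) ⟩
    ∑[ x < m ] indic (A x y ∧ A x y) ≡⟨ sum-cong-≗ (λ x → cong indic (∧-idem (A x y))) ⟩
    ∑[ x < m ] indic (A x y)         ≡⟨ sumFin≡sum m (λ x → indic (A x y)) ⟨
    degY A y                         ∎
    where open ≡-Reasoning

  commonNbrs≢0⇒common-neighbour : ∀ y₁ y₂ → commonNbrs A y₁ y₂ ≢ 0 → ∃ λ x → (A x y₁ ≡ true) × (A x y₂ ≡ true)
  commonNbrs≢0⇒common-neighbour y₁ y₂ c≢0 with any? (λ x → A x y₁ ∧ A x y₂ Bool.≟ true)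
  ... | yes (x , both) = x , ∧-conicalˡ (A x y₁) (A x y₂) both , ∧-conicalʳ (A x y₁) (A x y₂) both
  ... | no none = contradiction c≡0 c≢0
    where
    c≡0 : commonNbrs A y₁ y₂ ≡ 0
    c≡0 = trans (sumFin≡sum m (λ x → indic (A x y₁ ∧ A x y₂)))
      (trans (sum-cong-≗ (λ x → cong indic (¬-not (none ∘ (x ,_))))) (sum-replicate-zero m))

module CommonNeighbourCount {m n′ : ℕ} (A : BipGraph m (suc n′)) (s : Fin m → ℕ) {k μ : ℕ} (1≤μ : 1 ≤ μ)
  (degX≡s : ∀ x → degX A x ≡ s x) (regular : ∀ y → degY A y ≡ k)
  (constant-μ : ∀ y₁ y₂ → Dist2 A y₁ y₂ → commonNbrs A y₁ y₂ ≡ μ) where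

  private
    n = suc n′

  commonNbrs≤μ : ∀ {y₁ y₂} → y₁ ≢ y₂ → commonNbrs A y₁ y₂ ≤ μ
  commonNbrs≤μ {y₁} {y₂} y₁≢y₂ with commonNbrs A y₁ y₂ ≟ 0
  ... | yes c≡0 = ≤-trans (≤-reflexive c≡0) z≤n
  ... | no c≢0 = ≤-reflexive (constant-μ y₁ y₂ (y₁≢y₂ , commonNbrs≢0⇒common-neighbour A y₁ y₂ c≢0))

  commonNbrs≡μ⇒Dist2 : ∀ {y₁ y₂} → y₁ ≢ y₂ → commonNbrs A y₁ y₂ ≡ μ → Dist2 A y₁ y₂
  commonNbrs≡μ⇒Dist2 {y₁} {y₂} y₁≢y₂ c≡μ =
    y₁≢y₂ , commonNbrs≢0⇒common-neighbour A y₁ y₂ (λ c≡0 → <⇒≢ 1≤μ (trans (sym c≡0) c≡μ))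

  offDiagonalRow : Fin n → ℕ
  offDiagonalRow y₁ = ∑[ j < n′ ] commonNbrs A y₁ (punchIn y₁ j)

  row-sum : ∀ y₁ → ∑[ y₂ < n ] commonNbrs A y₁ y₂ ≡ k + offDiagonalRow y₁
  row-sum y₁ = trans (sum-remove {i = y₁} (commonNbrs A y₁))
    (cong (_+ offDiagonalRow y₁) (trans (commonNbrs-diagonal A y₁) (regular y₁)))

  offDiagonalRow≤ : ∀ y₁ → offDiagonalRow y₁ ≤ n′ * μ
  offDiagonalRow≤ y₁ = ≤-trans (sum-mono-≤ (λ j → commonNbrs≤μ (punchInᵢ≢i y₁ j ∘ sym))) (≤-reflexive (sum-const n′ μ))

  offDiagonalRow≡⇔ : ∀ y₁ → offDiagonalRow y₁ ≡ n′ * μ ⇔ (∀ y₂ → y₁ ≢ y₂ → Dist2 A y₁ y₂)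
  offDiagonalRow≡⇔ y₁ = mk⇔ to from
    where
    to : offDiagonalRow y₁ ≡ n′ * μ → ∀ y₂ → y₁ ≢ y₂ → Dist2 A y₁ y₂
    to row≡ y₂ y₁≢y₂ = subst (Dist2 A y₁) (punchIn-punchOut y₁≢y₂)
      (commonNbrs≡μ⇒Dist2 (punchInᵢ≢i y₁ j ∘ sym)
        (sum-mono-≤-≡⇒≗ (λ j → commonNbrs≤μ (punchInᵢ≢i y₁ j ∘ sym)) (trans row≡ (sym (sum-const n′ μ))) j))
      where j = punchOut y₁≢y₂
    from : (∀ y₂ → y₁ ≢ y₂ → Dist2 A y₁ y₂) → offDiagonalRow y₁ ≡ n′ * μ
    from dist2 = trans (sum-cong-≗ (λ j → constant-μ y₁ _ (dist2 (punchIn y₁ j) (punchInᵢ≢i y₁ j ∘ sym))))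
      (sum-const n′ μ)

  sum-s≡nk : sum s ≡ n * k
  sum-s≡nk = begin
    sum s        ≡⟨ sum-cong-≗ degX≡s ⟨
    sum (degX A) ≡⟨ sum-degX≡sum-degY A ⟩
    sum (degY A) ≡⟨ sum-cong-≗ regular ⟩
    ∑[ y < n ] k ≡⟨ sum-const n k ⟩
    n * k        ∎
    where open ≡-Reasoning

  sum-s²≡sum-rows : ∑[ x < m ] (s x * s x) ≡ ∑[ y₁ < n ] (k + offDiagonalRow y₁)
  sum-s²≡sum-rows = begin
    ∑[ x < m ] (s x * s x)               ≡⟨ sum-cong-≗ (λ x → cong (λ d → d * d) (degX≡s x)) ⟨
    ∑[ x < m ] (degX A x * degX A x)     ≡⟨ sum-degX²≡sum-commonNbrs A ⟩
    ∑[ y₁ < n ] ∑[ y₂ < n ] commonNbrs A y₁ y₂ ≡⟨ sum-cong-≗ row-sum ⟩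
    ∑[ y₁ < n ] (k + offDiagonalRow y₁)  ∎
    where open ≡-Reasoning

  sum-s²≤ : ∑[ x < m ] (s x * s x) ≤ n * (k + n′ * μ)
  sum-s²≤ = begin
    ∑[ x < m ] (s x * s x)              ≡⟨ sum-s²≡sum-rows ⟩
    ∑[ y₁ < n ] (k + offDiagonalRow y₁) ≤⟨ sum-mono-≤ (λ y₁ → +-monoʳ-≤ k (offDiagonalRow≤ y₁)) ⟩
    ∑[ y₁ < n ] (k + n′ * μ)            ≡⟨ sum-const n (k + n′ * μ) ⟩
    n * (k + n′ * μ)                    ∎
    where open ≤-Reasoning

  sum-s²≡⇔ : ∑[ x < m ] (s x * s x) ≡ n * (k + n′ * μ) ⇔ (∀ y₁ y₂ → y₁ ≢ y₂ → Dist2 A y₁ y₂)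
  sum-s²≡⇔ = mk⇔ to from
    where
    to : ∑[ x < m ] (s x * s x) ≡ n * (k + n′ * μ) → ∀ y₁ y₂ → y₁ ≢ y₂ → Dist2 A y₁ y₂
    to sum≡ y₁ = Equivalence.to (offDiagonalRow≡⇔ y₁) (+-cancelˡ-≡ k _ _
      (sum-mono-≤-≡⇒≗ (λ y₁ → +-monoʳ-≤ k (offDiagonalRow≤ y₁))
        (trans (sym sum-s²≡sum-rows) (trans sum≡ (sym (sum-const n (k + n′ * μ))))) y₁))
    from : (∀ y₁ y₂ → y₁ ≢ y₂ → Dist2 A y₁ y₂) → ∑[ x < m ] (s x * s x) ≡ n * (k + n′ * μ)
    from dist2 = trans sum-s²≡sum-rows (trans
      (sum-cong-≗ (λ y₁ → cong (_+_ k) (Equivalence.from (offDiagonalRow≡⇔ y₁) (dist2 y₁))))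
      (sum-const n (k + n′ * μ)))

-- toℚᵘ turns both sides into unnormalised fractions, on which ≤ and ≡ compare the integer cross products;
-- these differ by exactly m C - n k².
module _ (m′ n′ k μ : ℕ) where
  private
    m = suc m′
    n = suc n′
    C = k + n′ * μ

    lhs rhs : ℚ
    lhs = ((+ k) / 1) *ℚ (((+ (n * k)) / m) - 1ℚ)
    rhs = (((+ n) / 1) - 1ℚ) *ℚ ((+ μ) / 1)

    lhsᵘ rhsᵘ : ℚᵘ
    lhsᵘ = mkℚᵘ (+ k) 0 ℚᵘ.* (mkℚᵘ (+ (n * k)) m′ ℚᵘ.+ mkℚᵘ -[1+ 0 ] 0)
    rhsᵘ = (mkℚᵘ (+ n) 0 ℚᵘ.+ mkℚᵘ -[1+ 0 ] 0) ℚᵘ.* mkℚᵘ (+ μ) 0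

    toℚᵘ-lhs : toℚᵘ lhs ≃ lhsᵘ
    toℚᵘ-lhs = ℚᵘ.≃-trans (toℚᵘ-homo-* ((+ k) / 1) (((+ (n * k)) / m) - 1ℚ))
      (ℚᵘ.*-cong (toℚᵘ-fromℚᵘ (mkℚᵘ (+ k) 0))
        (ℚᵘ.≃-trans (toℚᵘ-homo-+ ((+ (n * k)) / m) (ℚ.- 1ℚ))
          (ℚᵘ.+-congˡ _ (toℚᵘ-fromℚᵘ (mkℚᵘ (+ (n * k)) m′)))))

    toℚᵘ-rhs : toℚᵘ rhs ≃ rhsᵘ
    toℚᵘ-rhs = ℚᵘ.≃-trans (toℚᵘ-homo-* (((+ n) / 1) - 1ℚ) ((+ μ) / 1))
      (ℚᵘ.*-cong
        (ℚᵘ.≃-trans (toℚᵘ-homo-+ ((+ n) / 1) (ℚ.- 1ℚ)) (ℚᵘ.+-congˡ _ (toℚᵘ-fromℚᵘ (mkℚᵘ (+ n) 0))))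
        (toℚᵘ-fromℚᵘ (mkℚᵘ (+ μ) 0)))

    cross-lhs cross-rhs : ℤ
    cross-lhs = ↥ lhsᵘ ℤ.* ↧ rhsᵘ
    cross-rhs = ↥ rhsᵘ ℤ.* ↧ lhsᵘ

    cross-difference : cross-rhs ℤ.- cross-lhs ≡ + (m * C) ℤ.- + (n * k * k)
    cross-difference = trans
      (expand (+ k) (+ n′) (+ m) (+ μ) ↧lhsᵘ≡m (ℤ.pos-* n k))
      (sym (cong₂ ℤ._-_ m*C≡ n*k*k≡))
      where
      ↧lhsᵘ≡m : ↧ lhsᵘ ≡ + m
      ↧lhsᵘ≡m = cong +_ (trans (*-identityˡ (m * 1)) (*-identityʳ m))
      m*C≡ : + (m * C) ≡ + m ℤ.* (+ k ℤ.+ + n′ ℤ.* + μ)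
      m*C≡ = trans (ℤ.pos-* m C) (cong (ℤ._*_ (+ m)) (trans (ℤ.pos-+ k (n′ * μ)) (cong (ℤ._+_ (+ k)) (ℤ.pos-* n′ μ))))
      n*k*k≡ : + (n * k * k) ≡ + n ℤ.* + k ℤ.* + k
      n*k*k≡ = trans (ℤ.pos-* (n * k) k) (cong (ℤ._* + k) (ℤ.pos-* n k))
      -- Stated in the literal shape that the ℚᵘ operations unfold to, so that it applies definitionally.
      expand : ∀ K N′ M U {D NK} → D ≡ M → NK ≡ (+ 1 ℤ.+ N′) ℤ.* K →
        ((+ 1 ℤ.+ N′) ℤ.* + 1 ℤ.+ ℤ.- + 1 ℤ.* + 1) ℤ.* U ℤ.* D ℤ.- K ℤ.* (NK ℤ.* + 1 ℤ.+ ℤ.- + 1 ℤ.* M) ℤ.* + 1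
          ≡ M ℤ.* (K ℤ.+ N′ ℤ.* U) ℤ.- (+ 1 ℤ.+ N′) ℤ.* K ℤ.* K
      expand K N′ M U refl refl = ring K N′ M U
        where
        ring : ∀ K N′ M U →
          ((+ 1 ℤ.+ N′) ℤ.* + 1 ℤ.+ ℤ.- + 1 ℤ.* + 1) ℤ.* U ℤ.* M ℤ.- K ℤ.* ((+ 1 ℤ.+ N′) ℤ.* K ℤ.* + 1 ℤ.+ ℤ.- + 1 ℤ.* M) ℤ.* + 1
            ≡ M ℤ.* (K ℤ.+ N′ ℤ.* U) ℤ.- (+ 1 ℤ.+ N′) ℤ.* K ℤ.* K
        ring = ℤ-Solver.solve-∀

  k[nk/m-1]≤[n-1]μ : n * k * k ≤ m * C →
    ((+ k) / 1) *ℚ (((+ (n * k)) / m) - 1ℚ) ℚ.≤ (((+ n) / 1) - 1ℚ) *ℚ ((+ μ) / 1)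
  k[nk/m-1]≤[n-1]μ nk²≤mC = toℚᵘ-cancel-≤ (ℚᵘ.≤-respˡ-≃ (ℚᵘ.≃-sym toℚᵘ-lhs) (ℚᵘ.≤-respʳ-≃ (ℚᵘ.≃-sym toℚᵘ-rhs)
    (*≤* (ℤ.0≤i-j⇒j≤i (subst (0ℤ ℤ.≤_) (sym cross-difference) (ℤ.i≤j⇒0≤j-i (+≤+ nk²≤mC)))))))

  [n-1]μ≡k[nk/m-1]⇔ : (((+ n) / 1) - 1ℚ) *ℚ ((+ μ) / 1) ≡ ((+ k) / 1) *ℚ (((+ (n * k)) / m) - 1ℚ)
                      ⇔ n * k * k ≡ m * C
  [n-1]μ≡k[nk/m-1]⇔ = mk⇔ to from
    where
    to : rhs ≡ lhs → n * k * k ≡ m * C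
    to rhs≡lhs with ℚᵘ.≃-trans (ℚᵘ.≃-sym toℚᵘ-rhs) (ℚᵘ.≃-trans (toℚᵘ-cong rhs≡lhs) toℚᵘ-lhs)
    ... | *≡* cross≡ = sym (ℤ.+-injective (ℤ.i-j≡0⇒i≡j (+ (m * C)) (+ (n * k * k))
      (trans (sym cross-difference) (trans (cong (ℤ._- cross-lhs) cross≡) (ℤ.+-inverseʳ cross-lhs)))))
    from : n * k * k ≡ m * C → rhs ≡ lhs
    from nk²≡mC = toℚᵘ-injective (ℚᵘ.≃-trans toℚᵘ-rhs (ℚᵘ.≃-trans (*≡* cross≡) (ℚᵘ.≃-sym toℚᵘ-lhs)))
      where
      cross≡ : cross-rhs ≡ cross-lhs
      cross≡ = ℤ.i-j≡0⇒i≡j cross-rhs cross-lhs (trans cross-difference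
        (trans (cong (λ x → + x ℤ.- + (n * k * k)) (sym nk²≡mC)) (ℤ.+-inverseʳ (+ (n * k * k)))))


lemma3p2 : (m n : ℕ) → .{{_ : NonZero m}} → 1 Data.Nat.≤ n →
    (A : BipGraph m n) → (s : Fin m → ℕ) → (k μ : ℕ) → 1 Data.Nat.≤ μ →
    (∀ i → degX A i ≡ s i) →
    (∀ y → degY A y ≡ k) →
    (∀ y₁ y₂ → Dist2 A y₁ y₂ → commonNbrs A y₁ y₂ ≡ μ) →
    ((((+ k) / 1) *ℚ (((+ (n * k)) / m) - 1ℚ))
      Data.Rational.≤ ((((+ n) / 1) - 1ℚ) *ℚ ((+ μ) / 1)))
    × (((((+ n) / 1) - 1ℚ) *ℚ ((+ μ) / 1)
          ≡ ((+ k) / 1) *ℚ (((+ (n * k)) / m) - 1ℚ))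
       ⇔ ((∀ i j → s i ≡ s j) × (∀ y₁ y₂ → y₁ ≢ y₂ → Dist2 A y₁ y₂)))
lemma3p2 (suc m′) (suc n′) _ A s k μ 1≤μ degX≡s regular constant-μ =
  k[nk/m-1]≤[n-1]μ m′ n′ k μ nk²≤mC ,
  ((cauchy-schwarz-≡⇔const s ×-⇔ sum-s²≡⇔) ⇔-∘ nk²≡mC⇔) ⇔-∘ [n-1]μ≡k[nk/m-1]⇔ m′ n′ k μ
  where
  open CommonNeighbourCount A s 1≤μ degX≡s regular constant-μ
  open BoundChain {n = suc n′} sum-s≡nk (cauchy-schwarz s) sum-s²≤
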